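{- For every integer $k\geq 3$, $ex^*(n,P_k) \geq \frac{k}{2}n + O(1)$ as $n\to\infty$.
   Context: $P_k$ denotes the path with $k$ edges (and $k+1$ vertices). An edge coloring of a graph is proper if any two edges sharing a vertex receive different colors. A subgraph is rainbow if all its edges receive distinct colors. For a fixed graph $F$, the rainbow Turán number $ex^*(n,F)$ is the maximum number of edges in a properly edge-colored graph on $n$ vertices containing no rainbow copy of $F$. -}

module Defs where

open import Data.Nat using (ℕ; suc; _<_; _≤_; _+_; _*_)
open import Data.Bool using (Bool; true; false; _∧_)
open import Data.Fin using (Fin; toℕ; inject₁) renaming (suc to fsuc)
open import Data.List using (List; length; filterᵇ; allFin; cartesianProduct)
open import Data.Product using (_×_; _,_; Σ; proj₁; proj₂)
open import Data.Nat using (_<ᵇ_)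
open import Relation.Binary.PropositionalEquality using (_≡_; _≢_)
open import Function.Definitions using (Injective)

record Graph (n : ℕ) : Set where
  field
    adj    : Fin n → Fin n → Bool
    sym    : ∀ u v → adj u v ≡ adj v u
    irrefl : ∀ v → adj v v ≡ false
open Graph public

Edge : ∀ {n} → Graph n → Fin n → Fin n → Set
Edge G u v = adj G u v ≡ true

edgeCount : ∀ {n} → Graph n → ℕ
edgeCount {n} G =
  length (filterᵇ (λ p → (toℕ (proj₁ p) <ᵇ toℕ (proj₂ p)) ∧ adj G (proj₁ p) (proj₂ p))
                  (cartesianProduct (allFin n) (allFin n)))

-- An edge coloring (colors are natural numbers); only its values on edges matter.
-- It must be symmetric so that it is a function of the (unordered) edge.
record EdgeColoring {n : ℕ} (G : Graph n) : Set where
  field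
    col    : Fin n → Fin n → ℕ
    colSym : ∀ u v → col u v ≡ col v u
open EdgeColoring public

Proper : ∀ {n} {G : Graph n} → EdgeColoring G → Set
Proper {n} {G} c = ∀ (u v w : Fin n) → Edge G u v → Edge G u w → v ≢ w → col c u v ≢ col c u w

-- A rainbow copy of the path P_k (k edges, k+1 vertices): distinct vertices
-- x_0,...,x_k, consecutive ones adjacent, and the k edges have distinct colors.
record RainbowPath {n : ℕ} {G : Graph n} (c : EdgeColoring G) (k : ℕ) : Set where
  field
    vtx      : Fin (suc k) → Fin n
    vtxInj   : Injective _≡_ _≡_ vtx
    isEdge   : ∀ (i : Fin k) → Edge G (vtx (inject₁ i)) (vtx (fsuc i))
    rainbow  : Injective _≡_ _≡_ (λ (i : Fin k) → col c (vtx (inject₁ i)) (vtx (fsuc i)))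

-- "ex*(n, P_k) ≥ m": some properly edge-colored graph on n vertices with
-- no rainbow P_k has at least m edges (ex* is the maximum of such edge counts).
ExStarPathAtLeast : ℕ → ℕ → ℕ → Set
ExStarPathAtLeast n k m =
  Σ (Graph n) λ G → Σ (EdgeColoring G) λ c →
    Proper c × ((RainbowPath c k → Data.Empty.⊥)) × (m ≤ edgeCount G)
  where import Data.Empty

module Submission where

-- Write k = M + 1 with M ≥ 2.  The folded (M+1)-cube is the Cayley graph of
-- (ℤ/2)^M with respect to the M+1 generators e_0, …, e_{M-1}, 1 (the unit
-- vectors and the all-ones vector).  It is (M+1)-regular, and colouring each
-- edge by its generator is proper.  The generators XOR to 0 and each of them
-- is used by a rainbow path with k edges exactly once, so such a path ends
-- where it starts: the colouring has no rainbow P_k.  The graph on n vertices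
-- is a disjoint union of ⌊n/2^M⌋ folded cubes plus isolated vertices, so
-- 2·|E| ≥ k (n - 2^M).

open import Defs hiding (sym)
open import Level using (0ℓ)
open import Data.Nat using (ℕ; zero; suc; _≤_; _<_; _+_; _*_; _^_; z≤n; s≤s; z<s; s<s; _<ᵇ_; ⌊_/2⌋; NonZero)
open import Data.Nat.Properties
open import Data.Nat.DivMod using (_/_; _%_; m≡m%n+[m/n]*n; m%n<n; m/n*n≤m)
open import Data.Nat.ListAction using (sum)
open import Data.Bool using (Bool; true; false; T; T?; _∧_; _xor_)
open import Data.Bool.Properties using (T-≡; T-∧; xor-comm; xor-same; xor-identityʳ; not-involutive; xor-∧-commutativeRing) renaming (_≟_ to _≟ᴮ_)
open import Data.Fin using (Fin; zero; suc; toℕ; fromℕ; fromℕ<; inject₁; punchOut)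
open import Data.Fin.Properties using (any?; injective⇒≤; punchOut-injective; toℕ-injective; toℕ-fromℕ<) renaming (_≟_ to _≟ᶠ_)
open import Data.Fin.Permutation using (Permutation′; permutation)
open import Data.Vec using (Vec; []; _∷_; lookup; replicate; zipWith)
open import Data.Vec.Properties using (zipWith-comm; lookup-zipWith; lookup-replicate; tabulate∘lookup; tabulate-cong; ∷-injective) renaming (≡-dec to ≡-decⱽ)
open import Data.List using (List; []; _∷_; _++_; length; map; filterᵇ; tabulate; allFin; cartesianProduct) renaming (lookup to entry)
open import Data.List.Properties using (filter-++; length-++; length-map; length-tabulate; map-tabulate)
open import Data.List.Membership.Propositional using (_∈_)
open import Data.List.Membership.Propositional.Properties using (∈-lookup; ∈-filter⁺; ∈-filter⁻; ∈-tabulate⁻; ∈-allFin; ∈-++⁺ˡ; ∈-++⁺ʳ; ∈-map⁺; ∈-cartesianProduct⁺)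
open import Data.List.Membership.Setoid.Properties using (index-injective)
open import Data.List.Relation.Unary.Any using (index)
import Data.List.Relation.Unary.All as All
open import Data.List.Relation.Unary.AllPairs using (_∷_)
open import Data.List.Relation.Unary.Unique.Propositional using (Unique)
open import Data.List.Relation.Unary.Unique.Propositional.Properties using (tabulate⁺; filter⁺; cartesianProduct⁺; allFin⁺)
open import Data.Product using (Σ; ∃; _×_; _,_; proj₁; proj₂; swap)
open import Data.Empty using (⊥; ⊥-elim)
open import Algebra.Bundles using (Monoid; CommutativeMonoid; CommutativeRing)
open import Function using (_∘_; Injective; Equivalence; mk⇔)
open import Relation.Binary.Definitions using (tri<; tri≈; tri>)
open import Relation.Binary.PropositionalEquality
open import Relation.Nullary using (Dec; yes; no; does; ¬_; _×-dec_; contradiction)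
open import Relation.Nullary.Decidable using (dec-true; dec-false; does-⇔)

unique⇒lookup-injective : {A : Set} {xs : List A} → Unique xs → Injective _≡_ _≡_ (entry xs)
unique⇒lookup-injective (x∉xs ∷ _) {zero}  {zero}  _ = refl
unique⇒lookup-injective (x∉xs ∷ _) {zero}  {suc j} e = ⊥-elim (All.lookup x∉xs (∈-lookup j) e)
unique⇒lookup-injective (x∉xs ∷ _) {suc i} {zero}  e = ⊥-elim (All.lookup x∉xs (∈-lookup i) (sym e))
unique⇒lookup-injective (_ ∷ u)    {suc i} {suc j} e = cong suc (unique⇒lookup-injective u e)

-- A duplicate-free list contained in another list is not longer: sending each
-- position of xs to the position of the same entry in ys is injective.
unique-⊆⇒length≤ : {A : Set} {xs ys : List A} → Unique xs → (∀ {x} → x ∈ xs → x ∈ ys) →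
                   length xs ≤ length ys
unique-⊆⇒length≤ {xs = xs} {ys} u xs⊆ys = injective⇒≤ position-injective
  where
  position : Fin (length xs) → Fin (length ys)
  position i = index (xs⊆ys (∈-lookup i))

  position-injective : Injective _≡_ _≡_ position
  position-injective {i} {j} e =
    unique⇒lookup-injective u (index-injective (setoid _) (xs⊆ys (∈-lookup i)) (xs⊆ys (∈-lookup j)) e)

count-cartesianProduct : {A B : Set} (R : A → B → Bool) (xs : List A) (ys : List B) →
  length (filterᵇ (λ p → R (proj₁ p) (proj₂ p)) (cartesianProduct xs ys))
    ≡ sum (map (λ x → length (filterᵇ (R x) ys)) xs)
count-cartesianProduct R [] ys = refl
count-cartesianProduct {A} {B} R (x ∷ xs) ys = begin
  length (filterᵇ R₂ (map (x ,_) ys ++ cartesianProduct xs ys))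
    ≡⟨ cong length (filter-++ (T? ∘ R₂) (map (x ,_) ys) _) ⟩
  length (filterᵇ R₂ (map (x ,_) ys) ++ filterᵇ R₂ (cartesianProduct xs ys))
    ≡⟨ length-++ (filterᵇ R₂ (map (x ,_) ys)) ⟩
  length (filterᵇ R₂ (map (x ,_) ys)) + length (filterᵇ R₂ (cartesianProduct xs ys))
    ≡⟨ cong₂ _+_ (count-row ys) (count-cartesianProduct R xs ys) ⟩
  length (filterᵇ (R x) ys) + sum (map (λ x → length (filterᵇ (R x) ys)) xs) ∎
  where
  open ≡-Reasoning
  R₂ : A × B → Bool
  R₂ p = R (proj₁ p) (proj₂ p)

  count-row : ∀ zs → length (filterᵇ R₂ (map (x ,_) zs)) ≡ length (filterᵇ (R x) zs)
  count-row [] = refl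
  count-row (z ∷ zs) with R x z
  ... | true  = cong suc (count-row zs)
  ... | false = count-row zs

sum-lower-bound : ∀ {n} (f : Fin n → ℕ) {Q K : ℕ} → Q ≤ n → (∀ i → toℕ i < Q → K ≤ f i) →
                  Q * K ≤ sum (tabulate f)
sum-lower-bound f {zero} _ _ = z≤n
sum-lower-bound f {suc Q} (s≤s Q≤n) large =
  +-mono-≤ (large zero z<s) (sum-lower-bound (f ∘ suc) Q≤n (λ i i<Q → large (suc i) (s<s i<Q)))

degree : ∀ {n} → Graph n → Fin n → ℕ
degree {n} G u = length (filterᵇ (adj G u) (allFin n))

-- Handshake lemma: every edge {u, v} is counted twice in the degree sum, once
-- as (u, v) and once as (v, u).  The ordered adjacent pairs form a duplicate-free
-- list inside  E ++ map swap E,  where E is the list counted by edgeCount.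
handshake : ∀ {n} (G : Graph n) → sum (tabulate (degree G)) ≤ 2 * edgeCount G
handshake {n} G = begin
  sum (tabulate (degree G))             ≡⟨ cong sum (map-tabulate (λ u → u) (degree G)) ⟨
  sum (map (degree G) (allFin n))       ≡⟨ count-cartesianProduct (adj G) (allFin n) (allFin n) ⟨
  length adjacentPairs                  ≤⟨ unique-⊆⇒length≤ adjacentPairs-unique adjacentPair∈edges ⟩
  length (edges ++ map swap edges)      ≡⟨ length-++ edges ⟩
  length edges + length (map swap edges) ≡⟨ cong (length edges +_) (length-map swap edges) ⟩
  length edges + length edges           ≡⟨ cong (length edges +_) (+-identityʳ _) ⟨
  2 * edgeCount G                       ∎
  where
  open ≤-Reasoning
  pairs : List (Fin n × Fin n)
  pairs = cartesianProduct (allFin n) (allFin n)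

  adjacent : Fin n × Fin n → Bool
  adjacent p = adj G (proj₁ p) (proj₂ p)

  increasing : Fin n × Fin n → Bool
  increasing p = (toℕ (proj₁ p) <ᵇ toℕ (proj₂ p)) ∧ adjacent p

  adjacentPairs edges : List (Fin n × Fin n)
  adjacentPairs = filterᵇ adjacent pairs
  edges         = filterᵇ increasing pairs

  adjacentPairs-unique : Unique adjacentPairs
  adjacentPairs-unique = filter⁺ _ (cartesianProduct⁺ (allFin⁺ n) (allFin⁺ n))

  edge∈edges : ∀ {u v} → toℕ u < toℕ v → T (adj G u v) → (u , v) ∈ edges
  edge∈edges u<v uv = ∈-filter⁺ _ (∈-cartesianProduct⁺ (∈-allFin _) (∈-allFin _))
                                  (Equivalence.from T-∧ (<⇒<ᵇ u<v , uv))

  adjacentPair∈edges : ∀ {p} → p ∈ adjacentPairs → p ∈ edges ++ map swap edges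
  adjacentPair∈edges {u , v} p∈ with proj₂ (∈-filter⁻ _ {xs = pairs} p∈) | <-cmp (toℕ u) (toℕ v)
  ... | uv | tri< u<v _ _ = ∈-++⁺ˡ (edge∈edges u<v uv)
  ... | uv | tri≈ _ u≡v _ = ⊥-elim (subst T (trans (cong (adj G u) (sym (toℕ-injective u≡v))) (irrefl G u)) uv)
  ... | uv | tri> _ _ v<u = ∈-++⁺ʳ edges (∈-map⁺ swap (edge∈edges v<u (subst T (Graph.sym G u v) uv)))

edges-from-degrees : ∀ {n} (G : Graph n) {Q K : ℕ} → Q ≤ n →
                     (∀ u → toℕ u < Q → K ≤ degree G u) → Q * K ≤ 2 * edgeCount G
edges-from-degrees G Q≤n large = ≤-trans (sum-lower-bound (degree G) Q≤n large) (handshake G)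

-- An injective map from Fin n to itself is onto: otherwise it would inject
-- Fin n into Fin n minus a point.
injective⇒surjective : ∀ {n} {σ : Fin n → Fin n} → Injective _≡_ _≡_ σ → ∀ y → ∃ λ x → σ x ≡ y
injective⇒surjective {suc n} {σ} σ-injective y with any? (λ x → σ x ≟ᶠ y)
... | yes hit  = hit
... | no  miss = contradiction (injective⇒≤ avoid-y-injective) (n≮n n)
  where
  avoid-y : Fin (suc n) → Fin n
  avoid-y x = punchOut {i = y} (λ y≡σx → miss (x , sym y≡σx))

  avoid-y-injective : Injective _≡_ _≡_ avoid-y
  avoid-y-injective e = σ-injective (punchOut-injective {i = y} _ _ e)

injective⇒permutation : ∀ {n} (σ : Fin n → Fin n) → Injective _≡_ _≡_ σ → Permutation′ n
injective⇒permutation σ σ-injective =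
  permutation σ (proj₁ ∘ onto) (proj₂ ∘ onto) (λ x → σ-injective (proj₂ (onto (σ x))))
  where onto = injective⇒surjective σ-injective

walk-constant : ∀ {k} {X : Set} (h : Fin (suc k) → X) → (∀ t → h (inject₁ t) ≡ h (suc t)) →
                h (fromℕ k) ≡ h zero
walk-constant {zero}  h preserved = refl
walk-constant {suc k} h preserved = trans (walk-constant (h ∘ suc) (preserved ∘ suc)) (sym (preserved zero))

module _ {c ℓ} (A : Monoid c ℓ) where
  open Monoid A using (Carrier; _≈_; _∙_; identityʳ; assoc; ∙-congʳ) renaming (sym to ≈-sym; setoid to A-setoid)
  open import Algebra.Properties.Monoid.Sum A using () renaming (sum to ∑)
  open import Relation.Binary.Reasoning.Setoid A-setoid

  telescope : ∀ {k} (h : Fin (suc k) → Carrier) (f : Fin k → Carrier) →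
              (∀ t → h (suc t) ≈ h (inject₁ t) ∙ f t) → h (fromℕ k) ≈ h zero ∙ ∑ f
  telescope {zero}  h f steps = ≈-sym (identityʳ (h zero))
  telescope {suc k} h f steps = begin
    h (fromℕ (suc k))                    ≈⟨ telescope (h ∘ suc) (f ∘ suc) (steps ∘ suc) ⟩
    h (suc zero) ∙ ∑ (f ∘ suc)           ≈⟨ ∙-congʳ (steps zero) ⟩
    (h zero ∙ f zero) ∙ ∑ (f ∘ suc)      ≈⟨ assoc (h zero) (f zero) (∑ (f ∘ suc)) ⟩
    h zero ∙ (f zero ∙ ∑ (f ∘ suc))      ∎

module _ {c ℓ} (A : CommutativeMonoid c ℓ) where
  open CommutativeMonoid A using (Carrier; _≈_)
  open import Algebra.Properties.CommutativeMonoid.Sum A using (sum-permute) renaming (sum to ∑)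

  sum-reindex : ∀ {n} (f : Fin n → Carrier) (σ : Fin n → Fin n) → Injective _≡_ _≡_ σ →
                ∑ f ≈ ∑ (f ∘ σ)
  sum-reindex f σ σ-injective = sum-permute f (injective⇒permutation σ σ-injective)

infixl 6 _⊕_
_⊕_ : ∀ {M} → Vec Bool M → Vec Bool M → Vec Bool M
_⊕_ = zipWith _xor_

⊕-comm : ∀ {M} (v w : Vec Bool M) → v ⊕ w ≡ w ⊕ v
⊕-comm = zipWith-comm xor-comm

⊕-self : ∀ {M} (v : Vec Bool M) → v ⊕ v ≡ replicate M false
⊕-self []      = refl
⊕-self (x ∷ v) = cong₂ _∷_ (xor-same x) (⊕-self v)

⊕-cancelˡ : ∀ {M} (v w : Vec Bool M) → v ⊕ (v ⊕ w) ≡ w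
⊕-cancelˡ []      []      = refl
⊕-cancelˡ (true  ∷ v) (y ∷ w) = cong₂ _∷_ (not-involutive y) (⊕-cancelˡ v w)
⊕-cancelˡ (false ∷ v) (y ∷ w) = cong (y ∷_) (⊕-cancelˡ v w)

⊕-injectiveʳ : ∀ {M} (v : Vec Bool M) {w w′ : Vec Bool M} → v ⊕ w ≡ v ⊕ w′ → w ≡ w′
⊕-injectiveʳ v {w} {w′} e = trans (sym (⊕-cancelˡ v w)) (trans (cong (v ⊕_) e) (⊕-cancelˡ v w′))

⊕-solveʳ : ∀ {M} {g v w : Vec Bool M} → g ≡ v ⊕ w → w ≡ v ⊕ g
⊕-solveʳ {v = v} {w} g≡v⊕w = trans (sym (⊕-cancelˡ v w)) (cong (v ⊕_) (sym g≡v⊕w))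

lookup-ext : ∀ {A : Set} {M} {v w : Vec A M} → (∀ j → lookup v j ≡ lookup w j) → v ≡ w
lookup-ext {v = v} {w} same = trans (sym (tabulate∘lookup v)) (trans (tabulate-cong same) (tabulate∘lookup w))

digit : Bool → ℕ
digit false = 0
digit true  = 1

-- x +2* b  is  x + 2b,  computed so that its digits can be read off by evaluation.
infixr 5 _+2*_
_+2*_ : Bool → ℕ → ℕ
x +2* zero  = digit x
x +2* suc b = suc (suc (x +2* b))

lowestBit : ℕ → Bool
lowestBit zero          = false
lowestBit (suc zero)    = true
lowestBit (suc (suc a)) = lowestBit a

+2*-value : ∀ x b → x +2* b ≡ digit x + 2 * b
+2*-value x zero    = sym (+-identityʳ (digit x))
+2*-value x (suc b) = begin
  suc (suc (x +2* b))              ≡⟨ cong (2 +_) (+2*-value x b) ⟩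
  suc (suc (digit x + 2 * b))      ≡⟨ cong suc (+-suc (digit x) (2 * b)) ⟨
  suc (digit x + suc (2 * b))      ≡⟨ +-suc (digit x) (suc (2 * b)) ⟨
  digit x + suc (suc (2 * b))      ≡⟨ cong (digit x +_) (*-suc 2 b) ⟨
  digit x + 2 * suc b              ∎
  where open ≡-Reasoning

lowestBit-+2* : ∀ x b → lowestBit (x +2* b) ≡ x
lowestBit-+2* false zero    = refl
lowestBit-+2* true  zero    = refl
lowestBit-+2* x     (suc b) = lowestBit-+2* x b

half-+2* : ∀ x b → ⌊ x +2* b /2⌋ ≡ b
half-+2* false zero    = refl
half-+2* true  zero    = refl
half-+2* x     (suc b) = cong suc (half-+2* x b)

lowestBit-+2*-half : ∀ a → lowestBit a +2* ⌊ a /2⌋ ≡ a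
lowestBit-+2*-half zero          = refl
lowestBit-+2*-half (suc zero)    = refl
lowestBit-+2*-half (suc (suc a)) = cong (2 +_) (lowestBit-+2*-half a)

half-< : ∀ {a X} → a < 2 * X → ⌊ a /2⌋ < X
half-< {a} {X} a<2X = *-cancelˡ-< 2 ⌊ a /2⌋ X (begin-strict
  2 * ⌊ a /2⌋                          ≤⟨ m≤n+m (2 * ⌊ a /2⌋) (digit (lowestBit a)) ⟩
  digit (lowestBit a) + 2 * ⌊ a /2⌋    ≡⟨ +2*-value (lowestBit a) ⌊ a /2⌋ ⟨
  lowestBit a +2* ⌊ a /2⌋              ≡⟨ lowestBit-+2*-half a ⟩
  a                                    <⟨ a<2X ⟩
  2 * X                                ∎)
  where open ≤-Reasoning

+2*-< : ∀ x {y Y} → y < Y → x +2* y < 2 * Y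
+2*-< x {y} {Y} y<Y = begin-strict
  x +2* y              ≡⟨ +2*-value x y ⟩
  digit x + 2 * y      ≤⟨ +-monoˡ-≤ (2 * y) (digit≤1 x) ⟩
  1 + 2 * y            <⟨ n<1+n (1 + 2 * y) ⟩
  2 + 2 * y            ≡⟨ *-suc 2 y ⟨
  2 * suc y            ≤⟨ *-monoʳ-≤ 2 y<Y ⟩
  2 * Y                ∎
  where
  open ≤-Reasoning
  digit≤1 : ∀ x → digit x ≤ 1
  digit≤1 false = z≤n
  digit≤1 true  = s≤s z≤n

-- Every natural number is  join b v = v₀ + 2 v₁ + … + 2^(M-1) v_(M-1) + 2^M b
-- for exactly one b and v: v = low M a lists its M lowest binary digits and
-- b = high M a is the number formed by the others.
low : (M : ℕ) → ℕ → Vec Bool M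
low zero    a = []
low (suc M) a = lowestBit a ∷ low M ⌊ a /2⌋

high : (M : ℕ) → ℕ → ℕ
high zero    a = a
high (suc M) a = high M ⌊ a /2⌋

join : ∀ {M} → ℕ → Vec Bool M → ℕ
join b []      = b
join b (x ∷ v) = x +2* join b v

join-high-low : ∀ M a → join (high M a) (low M a) ≡ a
join-high-low zero    a = refl
join-high-low (suc M) a = trans (cong (lowestBit a +2*_) (join-high-low M ⌊ a /2⌋)) (lowestBit-+2*-half a)

high-join : ∀ {M} b (v : Vec Bool M) → high M (join b v) ≡ b
high-join         b []      = refl
high-join {suc M} b (x ∷ v) = trans (cong (high M) (half-+2* x (join b v))) (high-join b v)

low-join : ∀ {M} b (v : Vec Bool M) → low M (join b v) ≡ v
low-join         b []      = refl
low-join {suc M} b (x ∷ v) = cong₂ _∷_ (lowestBit-+2* x (join b v))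
                                       (trans (cong (low M) (half-+2* x (join b v))) (low-join b v))

high-low-injective : ∀ M {a a′} → high M a ≡ high M a′ → low M a ≡ low M a′ → a ≡ a′
high-low-injective M {a} {a′} same-high same-low = begin
  a                              ≡⟨ join-high-low M a ⟨
  join (high M a) (low M a)      ≡⟨ cong₂ join same-high same-low ⟩
  join (high M a′) (low M a′)    ≡⟨ join-high-low M a′ ⟩
  a′                             ∎
  where open ≡-Reasoning

join-< : ∀ {M} b (v : Vec Bool M) → join b v < 2 ^ M * suc b
join-<         b []      = ≤-reflexive (sym (+-identityʳ (suc b)))
join-< {suc M} b (x ∷ v) = ≤-trans (+2*-< x (join-< b v)) (≤-reflexive (sym (*-assoc 2 (2 ^ M) (suc b))))

high-< : ∀ M {a q} → a < 2 ^ M * q → high M a < q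
high-< zero    {a} {q} a<q   = subst (a <_) (+-identityʳ q) a<q
high-< (suc M) {a} {q} a<2Mq = high-< M (half-< (subst (a <_) (*-assoc 2 (2 ^ M) q) a<2Mq))

unit : ∀ {M} → Fin M → Vec Bool M
unit {suc M} zero    = true ∷ replicate M false
unit         (suc i) = false ∷ unit i

generator : ∀ {M} → Fin (suc M) → Vec Bool M
generator {M} zero = replicate M true
generator (suc i)  = unit i

unit-injective : ∀ {M} → Injective _≡_ _≡_ (unit {M})
unit-injective {x = zero}  {zero}  _ = refl
unit-injective {x = suc i} {suc j} e = cong suc (unit-injective (proj₂ (∷-injective e)))

-- For M ≥ 2 the all-ones vector is not a unit vector, so the generators are distinct.
generator-injective : ∀ {d} → Injective _≡_ _≡_ (generator {suc (suc d)})
generator-injective {x = zero}  {zero}  _ = refl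
generator-injective {x = suc i} {suc j} e = cong suc (unit-injective e)
generator-injective {x = zero}  {suc zero}    ()
generator-injective {x = zero}  {suc (suc j)} ()
generator-injective {x = suc zero}    {zero}  ()
generator-injective {x = suc (suc i)} {zero}  ()

generator-nonzero : ∀ {M} (c : Fin (suc (suc M))) → generator c ≢ replicate (suc M) false
generator-nonzero zero ()
generator-nonzero (suc c) = unit-nonzero c
  where
  unit-nonzero : ∀ {M} (i : Fin M) → unit i ≢ replicate M false
  unit-nonzero zero    ()
  unit-nonzero (suc i) e = unit-nonzero i (proj₂ (∷-injective e))

IsGenerator : ∀ {M} → Vec Bool M → Set
IsGenerator v = ∃ λ c → generator c ≡ v

isGenerator? : ∀ {M} (v : Vec Bool M) → Dec (IsGenerator v)
isGenerator? v = any? (λ c → ≡-decⱽ _≟ᴮ_ (generator c) v)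

-- The index of a generator (and 0 for other vectors); used as the edge colour.
generatorIndex : ∀ {M} → Vec Bool M → ℕ
generatorIndex v with isGenerator? v
... | yes (c , _) = toℕ c
... | no  _       = 0

generatorIndex-generator : ∀ {d} (c : Fin (suc (suc (suc d)))) → generatorIndex (generator c) ≡ toℕ c
generatorIndex-generator c with isGenerator? (generator c)
... | yes (c′ , c′↦c) = cong toℕ (generator-injective c′↦c)
... | no  ¬generator  = ⊥-elim (¬generator (c , refl))

xor-commutativeMonoid : CommutativeMonoid 0ℓ 0ℓ
xor-commutativeMonoid = CommutativeRing.+-commutativeMonoid xor-∧-commutativeRing

open import Algebra.Properties.CommutativeMonoid.Sum xor-commutativeMonoid using () renaming (sum to xorSum; sum-replicate-zero to xorSum-false)

unit-column : ∀ {M} (j : Fin M) → xorSum (λ i → lookup (unit i) j) ≡ true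
unit-column {suc M} zero    = cong (true xor_) (xorSum-false M)
unit-column {suc M} (suc j) = cong₂ _xor_ (lookup-replicate j false) (unit-column j)

generator-column : ∀ {M} (j : Fin M) → xorSum (λ c → lookup (generator c) j) ≡ false
generator-column j = cong₂ _xor_ (lookup-replicate j true) (unit-column j)

-- A walk in (ℤ/2)^M that steps along each of the M+1 generators exactly once
-- returns to its start: coordinatewise, its displacement is the XOR of all
-- generators, reindexed by the order of the steps.
rainbow-walk-closes : ∀ {M} (w : Fin (suc (suc M)) → Vec Bool M) (c : Fin (suc M) → Fin (suc M)) →
  Injective _≡_ _≡_ c → (∀ t → w (suc t) ≡ w (inject₁ t) ⊕ generator (c t)) →
  w (fromℕ (suc M)) ≡ w zero
rainbow-walk-closes {M} w c c-injective steps = lookup-ext λ j → begin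
  lookup (w (fromℕ (suc M))) j
    ≡⟨ telescope (CommutativeMonoid.monoid xor-commutativeMonoid) (coordinate j) (step-bit j) (coordinate-step j) ⟩
  lookup (w zero) j xor xorSum (step-bit j)
    ≡⟨ cong (lookup (w zero) j xor_) (sum-reindex xor-commutativeMonoid (generator-bit j) c c-injective) ⟨
  lookup (w zero) j xor xorSum (generator-bit j)
    ≡⟨ cong (lookup (w zero) j xor_) (generator-column j) ⟩
  lookup (w zero) j xor false
    ≡⟨ xor-identityʳ (lookup (w zero) j) ⟩
  lookup (w zero) j ∎
  where
  open ≡-Reasoning
  coordinate : Fin M → Fin (suc (suc M)) → Bool
  coordinate j t = lookup (w t) j

  generator-bit : Fin M → Fin (suc M) → Bool
  generator-bit j g = lookup (generator g) j

  step-bit : Fin M → Fin (suc M) → Bool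
  step-bit j t = generator-bit j (c t)

  coordinate-step : ∀ j t → coordinate j (suc t) ≡ coordinate j (inject₁ t) xor step-bit j t
  coordinate-step j t = trans (cong (λ v → lookup v j) (steps t)) (lookup-zipWith _xor_ j (w (inject₁ t)) (generator (c t)))

does⇒proof : ∀ {P : Set} (p? : Dec P) → does p? ≡ true → P
does⇒proof (yes p) _ = p

proof⇒T : ∀ {P : Set} (p? : Dec P) → P → T (does p?)
proof⇒T p? p = Equivalence.from T-≡ (dec-true p? p)

-- Vertex a ∈ ℕ lies in block high M a and has coordinates low M a ∈ (ℤ/2)^M.
-- Each of the first q blocks carries a folded cube; these blocks fit into the
-- n vertices and all other vertices are isolated.
module FoldedCubes (d q n : ℕ) (blocks-fit : 2 ^ suc (suc d) * q ≤ n) where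
  M : ℕ
  M = suc (suc d)

  Adjacent : ℕ → ℕ → Set
  Adjacent a b = high M a < q × high M a ≡ high M b × IsGenerator (low M a ⊕ low M b)

  adjacent? : ∀ a b → Dec (Adjacent a b)
  adjacent? a b = high M a <? q ×-dec high M a ≟ high M b ×-dec isGenerator? (low M a ⊕ low M b)

  adjacent-sym : ∀ {a b} → Adjacent a b → Adjacent b a
  adjacent-sym {a} {b} (a<q , same , g) =
    subst (_< q) same a<q , sym same , subst IsGenerator (⊕-comm (low M a) (low M b)) g

  not-adjacent-self : ∀ a → ¬ Adjacent a a
  not-adjacent-self a (_ , _ , c , c↦0) = generator-nonzero c (trans c↦0 (⊕-self (low M a)))

  colour : ℕ → ℕ → ℕ
  colour a b = generatorIndex (low M a ⊕ low M b)

  graph : Graph n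
  graph = record
    { adj    = λ u v → does (adjacent? (toℕ u) (toℕ v))
    ; sym    = λ u v → does-⇔ (mk⇔ adjacent-sym adjacent-sym) (adjacent? (toℕ u) (toℕ v)) (adjacent? (toℕ v) (toℕ u))
    ; irrefl = λ u → dec-false (adjacent? (toℕ u) (toℕ u)) (not-adjacent-self (toℕ u))
    }

  colouring : EdgeColoring graph
  colouring = record
    { col    = λ u v → colour (toℕ u) (toℕ v)
    ; colSym = λ u v → cong generatorIndex (⊕-comm (low M (toℕ u)) (low M (toℕ v)))
    }

  record Step (a b : ℕ) : Set where
    field
      same-block : high M a ≡ high M b
      direction  : Fin (suc M)
      moves      : low M b ≡ low M a ⊕ generator direction
      coloured   : colour a b ≡ toℕ direction
  open Step

  step : ∀ {u v} → Edge graph u v → Step (toℕ u) (toℕ v)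
  step {u} {v} uv with does⇒proof (adjacent? (toℕ u) (toℕ v)) uv
  ... | _ , same , c , c↦ = record
    { same-block = same
    ; direction  = c
    ; moves      = ⊕-solveʳ c↦
    ; coloured   = trans (cong generatorIndex (sym c↦)) (generatorIndex-generator c)
    }

  steps-determined : ∀ {a b b′} (s : Step a b) (s′ : Step a b′) → direction s ≡ direction s′ → b ≡ b′
  steps-determined {a} {b} {b′} s s′ same-direction = high-low-injective M
    (trans (sym (same-block s)) (same-block s′))
    (begin
      low M b                                  ≡⟨ moves s ⟩
      low M a ⊕ generator (direction s)        ≡⟨ cong (λ g → low M a ⊕ generator g) same-direction ⟩
      low M a ⊕ generator (direction s′)       ≡⟨ moves s′ ⟨
      low M b′                                 ∎)
    where open ≡-Reasoning

  proper : Proper colouring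
  proper u v w uv uw v≢w same-colour =
    v≢w (toℕ-injective (steps-determined (step uv) (step uw) same-direction))
    where
    same-direction : direction (step uv) ≡ direction (step uw)
    same-direction = toℕ-injective (trans (sym (coloured (step uv))) (trans same-colour (coloured (step uw))))

  -- A rainbow P_(M+1) steps along every generator exactly once, so it stays in
  -- its block and returns to its starting coordinates: it is not a path.
  no-rainbow : RainbowPath colouring (suc M) → ⊥
  no-rainbow path = last≢first (vtxInj (toℕ-injective (high-low-injective M same-high same-low)))
    where
    open RainbowPath path
    x : Fin (suc (suc M)) → ℕ
    x t = toℕ (vtx t)

    steps : ∀ i → Step (x (inject₁ i)) (x (suc i))
    steps i = step (isEdge i)

    directions-injective : Injective _≡_ _≡_ (λ i → direction (steps i))
    directions-injective {i} {j} e =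
      rainbow (trans (coloured (steps i)) (trans (cong toℕ e) (sym (coloured (steps j)))))

    same-high : high M (x (fromℕ (suc M))) ≡ high M (x zero)
    same-high = walk-constant (high M ∘ x) (λ i → same-block (steps i))

    same-low : low M (x (fromℕ (suc M))) ≡ low M (x zero)
    same-low = rainbow-walk-closes (low M ∘ x) (λ i → direction (steps i)) directions-injective
                                   (λ i → moves (steps i))

    last≢first : fromℕ (suc M) ≢ zero
    last≢first ()

  -- A vertex in one of the first q blocks has M+1 distinct neighbours, one
  -- along each generator.
  degree-full : ∀ u → toℕ u < 2 ^ M * q → suc M ≤ degree graph u
  degree-full u u-low = subst (_≤ degree graph u) (length-tabulate neighbour)
                              (unique-⊆⇒length≤ (tabulate⁺ neighbour-injective) neighbour∈neighbourhood)
    where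
    a = toℕ u
    b = high M a

    b<q : b < q
    b<q = high-< M u-low

    fits : ∀ v → join b v < n
    fits v = <-≤-trans (join-< b v) (≤-trans (*-monoʳ-≤ (2 ^ M) b<q) blocks-fit)

    neighbour : Fin (suc M) → Fin n
    neighbour c = fromℕ< (fits (low M a ⊕ generator c))

    neighbour-high : ∀ c → high M (toℕ (neighbour c)) ≡ b
    neighbour-high c = trans (cong (high M) (toℕ-fromℕ< _)) (high-join b (low M a ⊕ generator c))

    neighbour-low : ∀ c → low M (toℕ (neighbour c)) ≡ low M a ⊕ generator c
    neighbour-low c = trans (cong (low M) (toℕ-fromℕ< _)) (low-join b (low M a ⊕ generator c))

    neighbour-adjacent : ∀ c → Adjacent a (toℕ (neighbour c))
    neighbour-adjacent c = b<q , sym (neighbour-high c) , c ,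
      sym (trans (cong (low M a ⊕_) (neighbour-low c)) (⊕-cancelˡ (low M a) (generator c)))

    neighbour-injective : Injective _≡_ _≡_ neighbour
    neighbour-injective {c} {c′} e = generator-injective (⊕-injectiveʳ (low M a)
      (trans (sym (neighbour-low c)) (trans (cong (low M ∘ toℕ) e) (neighbour-low c′))))

    neighbour∈neighbourhood : ∀ {v} → v ∈ tabulate neighbour → v ∈ filterᵇ (adj graph u) (allFin n)
    neighbour∈neighbourhood v∈ with ∈-tabulate⁻ {f = neighbour} v∈
    ... | c , refl = ∈-filter⁺ _ (∈-allFin _) (proof⇒T (adjacent? _ _) (neighbour-adjacent c))

  many-edges : 2 ^ M * q * suc M ≤ 2 * edgeCount graph
  many-edges = edges-from-degrees graph blocks-fit degree-full

below-next-multiple : ∀ n B .{{_ : NonZero B}} → n ≤ B * (n / B) + B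
below-next-multiple n B = begin
  n                     ≡⟨ m≡m%n+[m/n]*n n B ⟩
  n % B + n / B * B     ≤⟨ +-monoˡ-≤ (n / B * B) (<⇒≤ (m%n<n n B)) ⟩
  B + n / B * B         ≡⟨ +-comm B (n / B * B) ⟩
  n / B * B + B         ≡⟨ cong (_+ B) (*-comm (n / B) B) ⟩
  B * (n / B) + B       ∎
  where open ≤-Reasoning

theorem3p1 : ∀ (k : ℕ) → 3 ≤ k →
    Σ ℕ λ C → Σ ℕ λ N → ∀ (n : ℕ) → N ≤ n →
    Σ ℕ λ m → ExStarPathAtLeast n k m × (k * n ≤ 2 * m + C)
theorem3p1 (suc (suc (suc d))) (s≤s (s≤s (s≤s _))) = k * B , 0 , λ n _ → witness n
  where
  M k B : ℕ
  M = suc (suc d)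
  k = suc M
  B = 2 ^ M
  instance
    B-nonZero : NonZero B
    B-nonZero = m^n≢0 2 M

  witness : ∀ n → Σ ℕ λ m → ExStarPathAtLeast n k m × (k * n ≤ 2 * m + k * B)
  witness n = edgeCount graph , (graph , colouring , proper , no-rainbow , ≤-refl) , edge-bound
    where
    q : ℕ
    q = n / B
    open FoldedCubes d q n (subst (_≤ n) (*-comm q B) (m/n*n≤m n B))

    edge-bound : k * n ≤ 2 * edgeCount graph + k * B
    edge-bound = begin
      k * n                    ≤⟨ *-monoʳ-≤ k (below-next-multiple n B) ⟩
      k * (B * q + B)          ≡⟨ *-distribˡ-+ k (B * q) B ⟩
      k * (B * q) + k * B      ≤⟨ +-monoˡ-≤ (k * B) (subst (_≤ 2 * edgeCount graph) (*-comm (B * q) k) many-edges) ⟩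
      2 * edgeCount graph + k * B ∎
      where open ≤-Reasoning
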